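{- For any integer $n>2$ there exist a simple undirected graph $G$ on $n$ vertices and an edge $e\notin E(G)$ such that $|\Lambda(G,G+e)| = 3f(n-2)$.
   Context: A clique is a set of pairwise adjacent vertices; it is maximal if not properly contained in another clique. $\mathcal{C}(G)$ is the set of maximal cliques of $G$. $f(k)$ denotes the maximum number of maximal cliques of a simple undirected graph on $k$ vertices. $G+e$ is $G$ with the edge $e$ added. $\Lambda(G_1,G_2)$ is the symmetric difference of $\mathcal{C}(G_1)$ and $\mathcal{C}(G_2)$. -}

module Defs where

open import Data.Nat using (ℕ; _≤_)
open import Data.Bool using (Bool; true; false; _∨_; _∧_)
open import Data.Fin using (Fin; _≟_)
open import Data.Fin.Subset using (Subset; _∈_; _⊆_)
open import Data.List using (List; length)
import Data.List.Membership.Propositional as LM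
open import Data.List.Relation.Unary.Unique.Propositional using (Unique)
open import Data.Product using (Σ; ∃; _×_)
open import Data.Sum using (_⊎_)
open import Relation.Nullary using (¬_; does)
open import Relation.Binary.PropositionalEquality using (_≡_; _≢_)
open import Function.Bundles using (_⇔_)

Graph : ℕ → Set
Graph n = Fin n → Fin n → Bool

IsSimple : ∀ {n} → Graph n → Set
IsSimple {n} G = (∀ (i j : Fin n) → G i j ≡ G j i) × (∀ (i : Fin n) → G i i ≡ false)

IsClique : ∀ {n} → Graph n → Subset n → Set
IsClique {n} G S = ∀ (i j : Fin n) → i ∈ S → j ∈ S → i ≢ j → G i j ≡ true

IsMaxClique : ∀ {n} → Graph n → Subset n → Set
IsMaxClique {n} G S = IsClique G S × (∀ (T : Subset n) → IsClique G T → S ⊆ T → T ≡ S)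

HasCard : {A : Set} → (A → Set) → ℕ → Set
HasCard {A} P m = Σ (List A) λ xs → Unique xs × (∀ x → (x LM.∈ xs) ⇔ P x) × length xs ≡ m

NumMaxCliques : ∀ {n} → Graph n → ℕ → Set
NumMaxCliques G m = HasCard (IsMaxClique G) m

-- f(k) = m : m is the maximum number of maximal cliques of a simple graph on k vertices.
IsF : ℕ → ℕ → Set
IsF k m = (Σ (Graph k) λ G → IsSimple G × NumMaxCliques G m)
        × (∀ (G : Graph k) (m' : ℕ) → IsSimple G → NumMaxCliques G m' → m' ≤ m)

addEdge : ∀ {n} → Graph n → Fin n → Fin n → Graph n
addEdge G i j x y = G x y ∨ (does (x ≟ i) ∧ does (y ≟ j)) ∨ (does (x ≟ j) ∧ does (y ≟ i))

InΛ : ∀ {n} → Graph n → Graph n → Subset n → Set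
InΛ G₁ G₂ S = (IsMaxClique G₁ S × ¬ IsMaxClique G₂ S) ⊎ (IsMaxClique G₂ S × ¬ IsMaxClique G₁ S)

-- Let H attain f(n − 2) and let G be the join of H with two new non-adjacent vertices u, v.
-- The maximal cliques of a join are exactly the unions of maximal cliques of its two sides, so
-- C(G) = {{u} ∪ S, {v} ∪ S : S ∈ C(H)} and C(G + uv) = {{u, v} ∪ S : S ∈ C(H)}. These families are
-- disjoint, hence |Λ(G, G + uv)| = 3 |C(H)| = 3 f(n − 2).
-- Constructively, f(k) exists because the graphs on k vertices can be listed (up to pointwise
-- equality) and being a maximal clique is decidable, so f(k) is an argmax over a finite list.

module Submission where

open import Defs
open import Data.Bool using (Bool; true; false)
import Data.Bool.Properties as Bool
open import Data.Fin using (Fin; zero; suc; _≟_; _↑ˡ_; _↑ʳ_; splitAt)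
open import Data.Fin.Properties
  using (all?; splitAt-↑ˡ; splitAt-↑ʳ; splitAt⁻¹-↑ˡ; splitAt⁻¹-↑ʳ; ↑ˡ-injective; ↑ʳ-injective)
open import Data.Fin.Subset using (Subset; inside; outside; _⊆_)
open import Data.Fin.Subset.Properties using (_∈?_; _⊆?_; anySubset?)
open import Data.List using (List; []; _∷_; [_]; length; filter; map; _++_; cartesianProductWith)
open import Data.List.Properties using (length-++; length-map)
open import Data.List.Membership.Propositional using (_∈_)
open import Data.List.Membership.Propositional.Properties
  using (∈-filter⁺; ∈-filter⁻; ∈-map⁺; ∈-cartesianProductWith⁺; ∈-cartesianProductWith⁻)
open import Data.List.Extrema.Nat using (argmax; argmax-all; f[xs]≤f[argmax])
open import Data.List.Fresh as List# using (List#; fromList)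
import Data.List.Fresh.Membership.Setoid as FreshMembership
import Data.List.Fresh.Membership.Setoid.Properties as Freshₚ
import Data.List.Fresh.Relation.Unary.Any as Fresh
open import Data.List.Relation.Unary.Any using (here; there)
open import Data.List.Relation.Unary.All as All using ([]; _∷_)
open import Data.List.Relation.Unary.All.Properties using (all-filter)
open import Data.List.Relation.Unary.AllPairs using ([]; _∷_)
open import Data.List.Relation.Unary.Unique.Propositional using (Unique)
open import Data.List.Relation.Unary.Unique.Propositional.Properties
  using (filter⁺; cartesianProductWith⁺)
import Data.List.Relation.Unary.Enumerates.Setoid as Enumerates
open import Data.Nat using (ℕ; zero; suc; _+_; _*_; _≤_; _<_; _∸_; s≤s)
open import Data.Nat.Properties using (≤-trans; module ≤-Reasoning)
open import Data.Product using (Σ; _×_; _,_; proj₁; proj₂)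
open import Data.Product.Function.NonDependent.Propositional using (_×-⇔_)
open import Data.Sum using (_⊎_; inj₁; inj₂)
open import Data.Sum.Function.Propositional using (_⊎-⇔_)
open import Data.Vec using (Vec; []; _∷_; here; there; _[_]=_; lookup; tabulate)
import Data.Vec as Vec
open import Data.Vec.Properties using (∷-injective; ++-injective; ++-injectiveˡ; ++-injectiveʳ)
import Data.Vec.Properties as Vec
open import Function using (_∘_; id)
open import Function.Bundles using (_⇔_; mk⇔; Equivalence)
import Function.Properties.Equivalence as ⇔
open import Function.Related.TypeIsomorphisms using (¬-cong-⇔)
open import Relation.Binary.PropositionalEquality
  using (_≡_; _≢_; _≗_; refl; sym; trans; cong; cong₂; subst; setoid; module ≡-Reasoning)
open import Relation.Nullary using (¬_; Dec; ¬?)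
open import Relation.Nullary.Decidable using (map′; decidable-stable; _×-dec_; _⊎-dec_; _→-dec_)
open import Relation.Nullary.Negation using (∀⟶¬∃¬; ¬∃⟶∀¬)
open import Relation.Unary using (Decidable)

length-cartesianProductWith : ∀ {A B C : Set} (f : A → B → C) xs ys →
  length (cartesianProductWith f xs ys) ≡ length xs * length ys
length-cartesianProductWith f []       ys = refl
length-cartesianProductWith f (x ∷ xs) ys = begin
  length (map (f x) ys ++ cartesianProductWith f xs ys)        ≡⟨ length-++ (map (f x) ys) ⟩
  length (map (f x) ys) + length (cartesianProductWith f xs ys) ≡⟨ cong₂ _+_ (length-map (f x) ys)
                                                                    (length-cartesianProductWith f xs ys) ⟩
  length ys + length xs * length ys                             ∎
  where open ≡-Reasoning

IsEnumeration : {A : Set} → List A → Set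
IsEnumeration {A} = Enumerates.IsEnumeration (setoid A)

module _ {A : Set} where

  -- A unique list is a fresh list for _≢_, for which the library proves the pigeonhole bound.
  private
    open FreshMembership (setoid A) renaming (_∈_ to _∈#_)

    fresh : ∀ {xs} → Unique xs → List# A _≢_
    fresh = fromList

    length-fresh : ∀ {xs} (xs! : Unique xs) → List#.length (fresh xs!) ≡ length xs
    length-fresh []        = refl
    length-fresh (_ ∷ xs!) = cong suc (length-fresh xs!)

    ∈-fresh⁺ : ∀ {x xs} (xs! : Unique xs) → x ∈ xs → x ∈# fresh xs!
    ∈-fresh⁺ (_ ∷ _)   (here x≡y)  = Fresh.here x≡y
    ∈-fresh⁺ (_ ∷ xs!) (there x∈xs) = Fresh.there (∈-fresh⁺ xs! x∈xs)

    ∈-fresh⁻ : ∀ {x xs} (xs! : Unique xs) → x ∈# fresh xs! → x ∈ xs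
    ∈-fresh⁻ (_ ∷ _)   (Fresh.here x≡y)   = here x≡y
    ∈-fresh⁻ (_ ∷ xs!) (Fresh.there x∈xs) = there (∈-fresh⁻ xs! x∈xs)

  unique-length-mono : ∀ {xs ys : List A} → Unique xs → Unique ys →
                       (∀ {x} → x ∈ xs → x ∈ ys) → length xs ≤ length ys
  unique-length-mono {xs} {ys} xs! ys! xs⊆ys = begin
    length xs                ≡⟨ sym (length-fresh xs!) ⟩
    List#.length (fresh xs!) ≤⟨ Freshₚ.injection (setoid A) id
                                  (∈-fresh⁺ ys! ∘ xs⊆ys ∘ ∈-fresh⁻ xs!) ⟩
    List#.length (fresh ys!) ≡⟨ length-fresh ys! ⟩
    length ys                ∎
    where open ≤-Reasoning

  HasCard-resp : ∀ {P Q : A → Set} {m} → (∀ x → P x ⇔ Q x) → HasCard P m → HasCard Q m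
  HasCard-resp P⇔Q (xs , xs! , xs⇔P , length≡m) =
    xs , xs! , (λ x → ⇔.trans (xs⇔P x) (P⇔Q x)) , length≡m

  HasCard-mono : ∀ {P Q : A → Set} {m n} → (∀ x → P x → Q x) → HasCard P m → HasCard Q n → m ≤ n
  HasCard-mono P⇒Q (xs , xs! , xs⇔P , refl) (ys , ys! , ys⇔Q , refl) =
    unique-length-mono xs! ys! λ {x} x∈xs →
      Equivalence.from (ys⇔Q x) (P⇒Q x (Equivalence.to (xs⇔P x) x∈xs))

  HasCard-filter : ∀ {P : A → Set} (P? : Decidable P) {xs} → Unique xs → IsEnumeration xs →
                   HasCard P (length (filter P? xs))
  HasCard-filter P? {xs} xs! ∈xs =
    filter P? xs , filter⁺ P? xs! ,
    (λ x → mk⇔ (λ x∈ → proj₂ (∈-filter⁻ P? {xs = xs} x∈)) (∈-filter⁺ P? (∈xs x))) , refl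

  HasCard-++ : ∀ {m k a b} {P : Vec A m → Set} {Q : Vec A k → Set} {R : Vec A (m + k) → Set} →
               (∀ xs ys → R (xs Vec.++ ys) ⇔ (P xs × Q ys)) →
               HasCard P a → HasCard Q b → HasCard R (a * b)
  HasCard-++ {m} {R = R} R⇔P×Q (xss , xss! , xss⇔P , refl) (yss , yss! , yss⇔Q , refl) =
    cartesianProductWith Vec._++_ xss yss ,
    cartesianProductWith⁺ Vec._++_ (λ {xs} {xs′} → ++-injective xs xs′) xss! yss! ,
    (λ zs → mk⇔ to (from zs)) ,
    length-cartesianProductWith Vec._++_ xss yss
    where
    to : ∀ {zs} → zs ∈ cartesianProductWith Vec._++_ xss yss → R zs
    to zs∈ with ∈-cartesianProductWith⁻ Vec._++_ xss yss zs∈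
    ... | xs , ys , xs∈ , ys∈ , refl =
      Equivalence.from (R⇔P×Q xs ys) (Equivalence.to (xss⇔P xs) xs∈ , Equivalence.to (yss⇔Q ys) ys∈)
    from : ∀ zs → R zs → zs ∈ cartesianProductWith Vec._++_ xss yss
    from zs Rzs with Vec.splitAt m zs
    ... | xs , ys , refl =
      let Pxs , Qys = Equivalence.to (R⇔P×Q xs ys) Rzs
      in ∈-cartesianProductWith⁺ Vec._++_
           (Equivalence.from (xss⇔P xs) Pxs) (Equivalence.from (yss⇔Q ys) Qys)

  vectors : List A → ∀ n → List (Vec A n)
  vectors xs zero    = [ [] ]
  vectors xs (suc n) = cartesianProductWith _∷_ xs (vectors xs n)

  vectors-complete : ∀ {xs} → IsEnumeration xs → ∀ {n} → IsEnumeration (vectors xs n)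
  vectors-complete ∈xs []      = here refl
  vectors-complete ∈xs (x ∷ v) = ∈-cartesianProductWith⁺ _∷_ (∈xs x) (vectors-complete ∈xs v)

  vectors-unique : ∀ {xs} → Unique xs → ∀ n → Unique (vectors xs n)
  vectors-unique xs! zero    = [] ∷ []
  vectors-unique xs! (suc n) = cartesianProductWith⁺ _∷_ ∷-injective xs! (vectors-unique xs! n)

subsets : ∀ n → List (Subset n)
subsets = vectors (inside ∷ outside ∷ [])

subsets-complete : ∀ {n} → IsEnumeration (subsets n)
subsets-complete = vectors-complete λ where
  true  → here refl
  false → there (here refl)

subsets-unique : ∀ n → Unique (subsets n)
subsets-unique = vectors-unique (((λ ()) ∷ []) ∷ [] ∷ [])

allSubset? : ∀ {n} {P : Subset n → Set} → Decidable P → Dec (∀ p → P p)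
allSubset? P? = map′ (λ ¬∃¬P p → decidable-stable (P? p) (¬∃⟶∀¬ ¬∃¬P p)) ∀⟶¬∃¬
                     (¬? (anySubset? (¬? ∘ P?)))

module _ {n : ℕ} where

  infix 4 _≐_
  _≐_ : Graph n → Graph n → Set
  G ≐ H = ∀ i → G i ≗ H i

  ≐-sym : {G H : Graph n} → G ≐ H → H ≐ G
  ≐-sym G≐H i j = sym (G≐H i j)

  IsSimple-resp : {G H : Graph n} → G ≐ H → IsSimple G → IsSimple H
  IsSimple-resp G≐H (symmetric , loopless) =
    (λ i j → trans (sym (G≐H i j)) (trans (symmetric i j) (G≐H j i))) ,
    (λ i → trans (sym (G≐H i i)) (loopless i))

  IsClique-resp : {G H : Graph n} → G ≐ H → ∀ {S} → IsClique G S → IsClique H S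
  IsClique-resp G≐H clique i j i∈S j∈S i≢j = trans (sym (G≐H i j)) (clique i j i∈S j∈S i≢j)

  IsMaxClique-resp : {G H : Graph n} → G ≐ H → ∀ {S} → IsMaxClique G S → IsMaxClique H S
  IsMaxClique-resp G≐H (clique , maximal) =
    IsClique-resp G≐H clique , λ T T-clique → maximal T (IsClique-resp (≐-sym G≐H) T-clique)

  IsMaxClique-cong : {G H : Graph n} → G ≐ H → ∀ {S} → IsMaxClique G S ⇔ IsMaxClique H S
  IsMaxClique-cong G≐H = mk⇔ (IsMaxClique-resp G≐H) (IsMaxClique-resp (≐-sym G≐H))

  isSimple? : (G : Graph n) → Dec (IsSimple G)
  isSimple? G = (all? λ i → all? λ j → G i j Bool.≟ G j i) ×-dec (all? λ i → G i i Bool.≟ false)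

  isClique? : (G : Graph n) → Decidable (IsClique G)
  isClique? G S = all? λ i → all? λ j →
    i ∈? S →-dec j ∈? S →-dec ¬? (i ≟ j) →-dec G i j Bool.≟ true

  isMaxClique? : (G : Graph n) → Decidable (IsMaxClique G)
  isMaxClique? G S = isClique? G S ×-dec allSubset? λ T →
    isClique? G T →-dec S ⊆? T →-dec Vec.≡-dec Bool._≟_ T S

  maxCliqueCount : Graph n → ℕ
  maxCliqueCount G = length (filter (isMaxClique? G) (subsets n))

  numMaxCliques : (G : Graph n) → NumMaxCliques G (maxCliqueCount G)
  numMaxCliques G = HasCard-filter (isMaxClique? G) (subsets-unique n) subsets-complete

-- Graph k is a function type, so graphs are enumerated only up to ≐, through adjacency matrices.
fromAdjacency : ∀ {k} → Vec (Subset k) k → Graph k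
fromAdjacency M i j = lookup (lookup M i) j

toAdjacency : ∀ {k} → Graph k → Vec (Subset k) k
toAdjacency G = tabulate (tabulate ∘ G)

fromAdjacency-toAdjacency : ∀ {k} (G : Graph k) → fromAdjacency (toAdjacency G) ≐ G
fromAdjacency-toAdjacency G i j
  rewrite Vec.lookup∘tabulate (tabulate ∘ G) i = Vec.lookup∘tabulate (G i) j

graphs : ∀ k → List (Graph k)
graphs k = map fromAdjacency (vectors (subsets k) k)

graphs-complete : ∀ {k} (G : Graph k) → Σ (Graph k) λ G′ → G′ ∈ graphs k × G ≐ G′
graphs-complete G =
  fromAdjacency (toAdjacency G) ,
  ∈-map⁺ fromAdjacency (vectors-complete subsets-complete (toAdjacency G)) ,
  ≐-sym (fromAdjacency-toAdjacency G)

emptyGraph : ∀ {k} → Graph k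
emptyGraph _ _ = false

emptyGraph-simple : ∀ {k} → IsSimple (emptyGraph {k})
emptyGraph-simple = (λ _ _ → refl) , (λ _ → refl)

f-exists : ∀ k → Σ ℕ (IsF k)
f-exists k = maxCliqueCount G* , (G* , G*-simple , numMaxCliques G*) , G*-maximum
  where
  candidates : List (Graph k)
  candidates = filter isSimple? (graphs k)

  G* : Graph k
  G* = argmax maxCliqueCount emptyGraph candidates

  G*-simple : IsSimple G*
  G*-simple = argmax-all maxCliqueCount emptyGraph-simple (all-filter isSimple? (graphs k))

  G*-maximum : ∀ G m → IsSimple G → NumMaxCliques G m → m ≤ maxCliqueCount G*
  G*-maximum G m G-simple G-cliques =
    let G′ , G′∈graphs , G≐G′ = graphs-complete G in ≤-trans
      (HasCard-mono (λ _ → IsMaxClique-resp G≐G′) G-cliques (numMaxCliques G′))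
      (All.lookup (f[xs]≤f[argmax] {f = maxCliqueCount} emptyGraph candidates)
        (∈-filter⁺ isSimple? G′∈graphs (IsSimple-resp G≐G′ G-simple)))

module _ {A : Set} where

  []=-++-↑ˡ⁺ : ∀ {m k} {xs : Vec A m} {ys : Vec A k} {i v} → xs [ i ]= v → (xs Vec.++ ys) [ i ↑ˡ k ]= v
  []=-++-↑ˡ⁺ here      = here
  []=-++-↑ˡ⁺ (there p) = there ([]=-++-↑ˡ⁺ p)

  []=-++-↑ˡ⁻ : ∀ {m k} (xs : Vec A m) {ys : Vec A k} {i v} → (xs Vec.++ ys) [ i ↑ˡ k ]= v → xs [ i ]= v
  []=-++-↑ˡ⁻ (_ ∷ xs) {i = zero}  here      = here
  []=-++-↑ˡ⁻ (_ ∷ xs) {i = suc i} (there p) = there ([]=-++-↑ˡ⁻ xs p)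

  []=-++-↑ʳ⁺ : ∀ {m k} (xs : Vec A m) {ys : Vec A k} {i v} → ys [ i ]= v → (xs Vec.++ ys) [ m ↑ʳ i ]= v
  []=-++-↑ʳ⁺ []       p = p
  []=-++-↑ʳ⁺ (_ ∷ xs) p = there ([]=-++-↑ʳ⁺ xs p)

  []=-++-↑ʳ⁻ : ∀ {m k} (xs : Vec A m) {ys : Vec A k} {i v} → (xs Vec.++ ys) [ m ↑ʳ i ]= v → ys [ i ]= v
  []=-++-↑ʳ⁻ []       p         = p
  []=-++-↑ʳ⁻ (_ ∷ xs) (there p) = []=-++-↑ʳ⁻ xs p

module _ {m k : ℕ} where

  data Split : Fin (m + k) → Set where
    left  : (x : Fin m) → Split (x ↑ˡ k)
    right : (y : Fin k) → Split (m ↑ʳ y)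

  split : ∀ i → Split i
  split i with splitAt m i in eq
  ... | inj₁ x = subst Split (splitAt⁻¹-↑ˡ eq) (left x)
  ... | inj₂ y = subst Split (splitAt⁻¹-↑ʳ eq) (right y)

  joinAdjacency : Graph m → Graph k → Fin m ⊎ Fin k → Fin m ⊎ Fin k → Bool
  joinAdjacency A B (inj₁ x) (inj₁ y) = A x y
  joinAdjacency A B (inj₁ x) (inj₂ y) = true
  joinAdjacency A B (inj₂ x) (inj₁ y) = true
  joinAdjacency A B (inj₂ x) (inj₂ y) = B x y

  infixr 6 _⊕_
  _⊕_ : Graph m → Graph k → Graph (m + k)
  (A ⊕ B) i j = joinAdjacency A B (splitAt m i) (splitAt m j)

  module _ {A : Graph m} {B : Graph k} where

    ⊕-ˡˡ : ∀ x y → (A ⊕ B) (x ↑ˡ k) (y ↑ˡ k) ≡ A x y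
    ⊕-ˡˡ x y = cong₂ (joinAdjacency A B) (splitAt-↑ˡ m x k) (splitAt-↑ˡ m y k)

    ⊕-ˡʳ : ∀ x y → (A ⊕ B) (x ↑ˡ k) (m ↑ʳ y) ≡ true
    ⊕-ˡʳ x y = cong₂ (joinAdjacency A B) (splitAt-↑ˡ m x k) (splitAt-↑ʳ m k y)

    ⊕-ʳˡ : ∀ x y → (A ⊕ B) (m ↑ʳ x) (y ↑ˡ k) ≡ true
    ⊕-ʳˡ x y = cong₂ (joinAdjacency A B) (splitAt-↑ʳ m k x) (splitAt-↑ˡ m y k)

    ⊕-ʳʳ : ∀ x y → (A ⊕ B) (m ↑ʳ x) (m ↑ʳ y) ≡ B x y
    ⊕-ʳʳ x y = cong₂ (joinAdjacency A B) (splitAt-↑ʳ m k x) (splitAt-↑ʳ m k y)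

    ⊕-simple : IsSimple A → IsSimple B → IsSimple (A ⊕ B)
    ⊕-simple (A-sym , A-loopless) (B-sym , B-loopless) =
      (λ i j → symmetric (splitAt m i) (splitAt m j)) , (λ i → loopless (splitAt m i))
      where
      symmetric : ∀ s t → joinAdjacency A B s t ≡ joinAdjacency A B t s
      symmetric (inj₁ x) (inj₁ y) = A-sym x y
      symmetric (inj₁ x) (inj₂ y) = refl
      symmetric (inj₂ x) (inj₁ y) = refl
      symmetric (inj₂ x) (inj₂ y) = B-sym x y
      loopless : ∀ s → joinAdjacency A B s s ≡ false
      loopless (inj₁ x) = A-loopless x
      loopless (inj₂ y) = B-loopless y

    ⊕-clique⁻ : ∀ {S T} → IsClique (A ⊕ B) (S Vec.++ T) → IsClique A S × IsClique B T
    ⊕-clique⁻ clique =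
      (λ x y x∈S y∈S x≢y → trans (sym (⊕-ˡˡ x y))
        (clique _ _ ([]=-++-↑ˡ⁺ x∈S) ([]=-++-↑ˡ⁺ y∈S) (x≢y ∘ ↑ˡ-injective k x y))) ,
      (λ x y x∈T y∈T x≢y → trans (sym (⊕-ʳʳ x y))
        (clique _ _ ([]=-++-↑ʳ⁺ _ x∈T) ([]=-++-↑ʳ⁺ _ y∈T) (x≢y ∘ ↑ʳ-injective m x y)))

    ⊕-clique⁺ : ∀ {S T} → IsClique A S → IsClique B T → IsClique (A ⊕ B) (S Vec.++ T)
    ⊕-clique⁺ {S} A-clique B-clique i j i∈ j∈ i≢j with split i | split j
    ... | left x  | left y  = trans (⊕-ˡˡ x y)
      (A-clique x y ([]=-++-↑ˡ⁻ S i∈) ([]=-++-↑ˡ⁻ S j∈) (i≢j ∘ cong (_↑ˡ k)))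
    ... | left x  | right y = ⊕-ˡʳ x y
    ... | right x | left y  = ⊕-ʳˡ x y
    ... | right x | right y = trans (⊕-ʳʳ x y)
      (B-clique x y ([]=-++-↑ʳ⁻ S i∈) ([]=-++-↑ʳ⁻ S j∈) (i≢j ∘ cong (m ↑ʳ_)))

  ++-⊆⁺ : ∀ {S S′ : Subset m} {T T′ : Subset k} → S ⊆ S′ → T ⊆ T′ → S Vec.++ T ⊆ S′ Vec.++ T′
  ++-⊆⁺ {S} {S′} S⊆S′ T⊆T′ {i} i∈ with split i
  ... | left x  = []=-++-↑ˡ⁺ (S⊆S′ ([]=-++-↑ˡ⁻ S i∈))
  ... | right y = []=-++-↑ʳ⁺ S′ (T⊆T′ ([]=-++-↑ʳ⁻ S i∈))

  ++-⊆⁻ : ∀ {S S′ : Subset m} {T T′ : Subset k} → S Vec.++ T ⊆ S′ Vec.++ T′ → S ⊆ S′ × T ⊆ T′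
  ++-⊆⁻ {S} {S′} ST⊆S′T′ =
    (λ x∈S → []=-++-↑ˡ⁻ S′ (ST⊆S′T′ ([]=-++-↑ˡ⁺ x∈S))) ,
    (λ y∈T → []=-++-↑ʳ⁻ S′ (ST⊆S′T′ ([]=-++-↑ʳ⁺ S y∈T)))

  module _ {A : Graph m} {B : Graph k} where

    ⊕-maxClique : ∀ {S T} → IsMaxClique (A ⊕ B) (S Vec.++ T) ⇔ (IsMaxClique A S × IsMaxClique B T)
    ⊕-maxClique {S} {T} = mk⇔ to from
      where
      to : IsMaxClique (A ⊕ B) (S Vec.++ T) → IsMaxClique A S × IsMaxClique B T
      to (clique , maximal) =
        let A-clique , B-clique = ⊕-clique⁻ clique in
        (A-clique , λ S′ S′-clique S⊆S′ → ++-injectiveˡ S′ S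
          (maximal (S′ Vec.++ T) (⊕-clique⁺ S′-clique B-clique) (++-⊆⁺ S⊆S′ id))) ,
        (B-clique , λ T′ T′-clique T⊆T′ → ++-injectiveʳ S S
          (maximal (S Vec.++ T′) (⊕-clique⁺ A-clique T′-clique) (++-⊆⁺ id T⊆T′)))

      from : IsMaxClique A S × IsMaxClique B T → IsMaxClique (A ⊕ B) (S Vec.++ T)
      from ((A-clique , A-maximal) , (B-clique , B-maximal)) = ⊕-clique⁺ A-clique B-clique , maximal
        where
        maximal : ∀ U → IsClique (A ⊕ B) U → S Vec.++ T ⊆ U → U ≡ S Vec.++ T
        maximal U U-clique ST⊆U with Vec.splitAt m U
        ... | S′ , T′ , refl =
          let S′-clique , T′-clique = ⊕-clique⁻ U-clique
              S⊆S′ , T⊆T′ = ++-⊆⁻ ST⊆U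
          in cong₂ Vec._++_ (A-maximal S′ S′-clique S⊆S′) (B-maximal T′ T′-clique T⊆T′)

symmetricDifference-×ʳ : ∀ {P Q R : Set} →
  (((P × R) × ¬ (Q × R)) ⊎ ((Q × R) × ¬ (P × R))) ⇔ (((P × ¬ Q) ⊎ (Q × ¬ P)) × R)
symmetricDifference-×ʳ = mk⇔
  (λ { (inj₁ ((p , r) , ¬qr)) → inj₁ (p , λ q → ¬qr (q , r)) , r
     ; (inj₂ ((q , r) , ¬pr)) → inj₂ (q , λ p → ¬pr (p , r)) , r })
  (λ { (inj₁ (p , ¬q) , r) → inj₁ ((p , r) , ¬q ∘ proj₁)
     ; (inj₂ (q , ¬p) , r) → inj₂ ((q , r) , ¬p ∘ proj₁) })

module _ {m k : ℕ} {A B : Graph m} {H : Graph k} where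

  InΛ-⊕ : ∀ S T → InΛ (A ⊕ H) (B ⊕ H) (S Vec.++ T) ⇔ (InΛ A B S × IsMaxClique H T)
  InΛ-⊕ S T = ⇔.trans
    ((⊕-maxClique ×-⇔ ¬-cong-⇔ ⊕-maxClique) ⊎-⇔ (⊕-maxClique ×-⇔ ¬-cong-⇔ ⊕-maxClique))
    symmetricDifference-×ʳ

  Λ-⊕-card : ∀ {a b} → HasCard (InΛ A B) a → NumMaxCliques H b → HasCard (InΛ (A ⊕ H) (B ⊕ H)) (a * b)
  Λ-⊕-card = HasCard-++ InΛ-⊕

module _ {n : ℕ} where

  inΛ? : (G₁ G₂ : Graph n) → Decidable (InΛ G₁ G₂)
  inΛ? G₁ G₂ S = (isMaxClique? G₁ S ×-dec ¬? (isMaxClique? G₂ S)) ⊎-dec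
                 (isMaxClique? G₂ S ×-dec ¬? (isMaxClique? G₁ S))

  InΛ-congʳ : ∀ {G₁ G₂ G₂′ : Graph n} → G₂ ≐ G₂′ → ∀ S → InΛ G₁ G₂ S ⇔ InΛ G₁ G₂′ S
  InΛ-congʳ G₂≐G₂′ S =
    (⇔.refl ×-⇔ ¬-cong-⇔ (IsMaxClique-cong G₂≐G₂′)) ⊎-⇔ (IsMaxClique-cong G₂≐G₂′ ×-⇔ ⇔.refl)

-- Λ(K̄₂, K₂) = {{0}, {1}, {0, 1}}; the count is obtained by evaluation.
Λ-emptyGraph-K₂ : HasCard (InΛ emptyGraph (addEdge emptyGraph zero (suc zero))) 3
Λ-emptyGraph-K₂ = HasCard-filter (inΛ? emptyGraph _) (subsets-unique 2) subsets-complete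

addEdge-⊕ : ∀ {k} (A : Graph 2) (H : Graph k) →
  addEdge (A ⊕ H) zero (suc zero) ≐ addEdge A zero (suc zero) ⊕ H
addEdge-⊕ A H zero          zero          = refl
addEdge-⊕ A H zero          (suc zero)    = refl
addEdge-⊕ A H zero          (suc (suc j)) = refl
addEdge-⊕ A H (suc zero)    zero          = refl
addEdge-⊕ A H (suc zero)    (suc zero)    = refl
addEdge-⊕ A H (suc zero)    (suc (suc j)) = refl
addEdge-⊕ A H (suc (suc i)) zero          = refl
addEdge-⊕ A H (suc (suc i)) (suc zero)    = refl
addEdge-⊕ A H (suc (suc i)) (suc (suc j)) = Bool.∨-identityʳ (H i j)

Λ-addEdge-emptyGraph⊕ : ∀ {k} {H : Graph k} {m} → NumMaxCliques H m →
  HasCard (InΛ (emptyGraph ⊕ H) (addEdge (emptyGraph ⊕ H) zero (suc zero))) (3 * m)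
Λ-addEdge-emptyGraph⊕ {H = H} H-cliques =
  HasCard-resp (InΛ-congʳ (≐-sym (addEdge-⊕ emptyGraph H))) (Λ-⊕-card Λ-emptyGraph-K₂ H-cliques)

lemma2 : ∀ (n : ℕ) → 2 < n →
    Σ ℕ λ m → IsF (n ∸ 2) m ×
      (Σ (Graph n) λ G → IsSimple G ×
        (Σ (Fin n) λ i → Σ (Fin n) λ j → i ≢ j × G i j ≡ false ×
          HasCard (InΛ G (addEdge G i j)) (3 * m)))
lemma2 (suc zero) (s≤s ())
lemma2 (suc (suc k)) _ =
  let m , isF = f-exists k
      (H , H-simple , H-cliques) , _ = isF
  in m , isF , emptyGraph ⊕ H , ⊕-simple emptyGraph-simple H-simple ,
     zero , suc zero , (λ ()) , refl , Λ-addEdge-emptyGraph⊕ H-cliques
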